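{- Let $\Sigma=\{L,X,R\}$ with the linear order $L<_{\mathrm{lex}}X<_{\mathrm{lex}}R$, and let $\Sigma^*$ be the set of all finite words over $\Sigma$. For $w,w'\in\Sigma^*$ put $w\prec w'$ if and only if there exists $0\le i<\min(|w|,|w'|)$ such that $(w_i,w'_i)=(L,R)$ and $w_j\le_{\mathrm{lex}}w'_j$ for every $0\le j<i$; put $w\preceq w'$ if and only if $w=w'$ or $w\prec w'$. Then $(\Sigma^*,\preceq)$ is a partial order.
   Context: For a word $w$, $|w|$ is its length and $w_j$ its letter at index $j$, indices starting at $0$. -}

module Defs where

open import Data.Nat using (ℕ; _<_; _⊓_)
open import Data.List using (List; length; lookup)
open import Data.Fin using (Fin; fromℕ<)
open import Data.Fin.Properties using ()
open import Data.Nat.Properties using (<-≤-trans; m⊓n≤m; m⊓n≤n)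
open import Data.Product using (Σ; _×_; ∃-syntax)
open import Data.Sum using (_⊎_)
open import Relation.Binary.PropositionalEquality using (_≡_)

data Letter : Set where
  L X R : Letter

data _≤lex_ : Letter → Letter → Set where
  L≤L : L ≤lex L
  L≤X : L ≤lex X
  L≤R : L ≤lex R
  X≤X : X ≤lex X
  X≤R : X ≤lex R
  R≤R : R ≤lex R

Word : Set
Word = List Letter

at : (w : Word) (j : ℕ) → j < length w → Letter
at w j p = lookup w (fromℕ< p)

_≺_ : Word → Word → Set
w ≺ w' =
  ∃[ i ] Σ (i < length w ⊓ length w') λ i<m →
    (at w i (<-≤-trans i<m (m⊓n≤m (length w) (length w'))) ≡ L
      × at w' i (<-≤-trans i<m (m⊓n≤n (length w) (length w'))) ≡ R)
    × (∀ j (j<i : j < i) (j<m : j < length w ⊓ length w') →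
         at w j (<-≤-trans j<m (m⊓n≤m (length w) (length w')))
           ≤lex at w' j (<-≤-trans j<m (m⊓n≤n (length w) (length w'))))

_⪯_ : Word → Word → Set
w ⪯ w' = (w ≡ w') ⊎ (w ≺ w')

-- Composing witnesses at i and k gives a witness at min(i, k):
-- the prefix conditions compose by transitivity of ≤lex, and at the smaller index the
-- letter L (resp. R) can only be followed (resp. preceded) by itself. The indices
-- cannot coincide, as the middle word would carry both R and L there. Since ≺ is
-- irreflexive, it is a strict partial order and its reflexive closure ⪯ a partial order.
module Submission where

open import Defs
open import Data.Empty using (⊥)
open import Data.Nat using (ℕ; _<_)
open import Data.Nat.Properties using (<-irrelevant; <-cmp; <-trans; ⊓-glb; <-≤-trans; m⊓n≤m; m⊓n≤n)
open import Data.List using (length)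
open import Data.Product using (_,_; proj₂; ∃-syntax)
open import Data.Sum using (inj₁; inj₂)
open import Relation.Binary.Definitions using (Transitive; Irreflexive; Asymmetric; Antisymmetric; tri<; tri≈; tri>)
open import Relation.Binary.PropositionalEquality
open import Relation.Binary.Structures using (IsPartialOrder)
open import Relation.Nullary using (¬_)

≤lex-trans : ∀ {a b c} → a ≤lex b → b ≤lex c → a ≤lex c
≤lex-trans L≤L q   = q
≤lex-trans L≤X X≤X = L≤X
≤lex-trans L≤X X≤R = L≤R
≤lex-trans L≤R R≤R = L≤R
≤lex-trans X≤X q   = q
≤lex-trans X≤R R≤R = X≤R
≤lex-trans R≤R q   = q

R≤lex⇒≡R : ∀ {a} → R ≤lex a → a ≡ R
R≤lex⇒≡R R≤R = refl

≤lexL⇒≡L : ∀ {a} → a ≤lex L → a ≡ L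
≤lexL⇒≡L L≤L = refl

at-irrelevant : ∀ w {j} (p q : j < length w) → at w j p ≡ at w j q
at-irrelevant w p q = cong (at w _) (<-irrelevant p q)

record _≺⟨_⟩_ (w : Word) (i : ℕ) (w′ : Word) : Set where
  field
    i<∣w∣   : i < length w
    i<∣w′∣  : i < length w′
    left-L  : at w i i<∣w∣ ≡ L
    right-R : at w′ i i<∣w′∣ ≡ R
    prefix-≤lex : ∀ {j} → j < i → (p : j < length w) (q : j < length w′) →
                  at w j p ≤lex at w′ j q

open _≺⟨_⟩_

≺⇒≺⟨⟩ : ∀ {w w′} → w ≺ w′ → ∃[ i ] w ≺⟨ i ⟩ w′
≺⇒≺⟨⟩ {w} {w′} (i , i<m , (wᵢ≡L , w′ᵢ≡R) , prefix) = i , record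
  { i<∣w∣   = <-≤-trans i<m ⊓≤∣w∣
  ; i<∣w′∣  = <-≤-trans i<m ⊓≤∣w′∣
  ; left-L  = wᵢ≡L
  ; right-R = w′ᵢ≡R
  ; prefix-≤lex = λ {j} j<i p q → let j<m = <-trans j<i i<m in
      subst₂ _≤lex_ (at-irrelevant w (<-≤-trans j<m ⊓≤∣w∣) p)
                    (at-irrelevant w′ (<-≤-trans j<m ⊓≤∣w′∣) q)
                    (prefix j j<i j<m)
  }
  where
  ⊓≤∣w∣  = m⊓n≤m (length w) (length w′)
  ⊓≤∣w′∣ = m⊓n≤n (length w) (length w′)

≺⟨⟩⇒≺ : ∀ {w i w′} → w ≺⟨ i ⟩ w′ → w ≺ w′
≺⟨⟩⇒≺ {w} {i} {w′} d =
  i , i<m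
    , ( trans (at-irrelevant w (<-≤-trans i<m ⊓≤∣w∣) (i<∣w∣ d)) (left-L d)
      , trans (at-irrelevant w′ (<-≤-trans i<m ⊓≤∣w′∣) (i<∣w′∣ d)) (right-R d) )
    , λ j j<i j<m → prefix-≤lex d j<i (<-≤-trans j<m ⊓≤∣w∣) (<-≤-trans j<m ⊓≤∣w′∣)
  where
  i<m    = ⊓-glb (i<∣w∣ d) (i<∣w′∣ d)
  ⊓≤∣w∣  = m⊓n≤m (length w) (length w′)
  ⊓≤∣w′∣ = m⊓n≤n (length w) (length w′)

≺⟨⟩-irrefl : ∀ {w i} → ¬ w ≺⟨ i ⟩ w
≺⟨⟩-irrefl {w} d with () ← trans (sym (left-L d)) (trans (at-irrelevant w (i<∣w∣ d) (i<∣w′∣ d)) (right-R d))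

≺⟨⟩-index-distinct : ∀ {w w′ w″ i} → w ≺⟨ i ⟩ w′ → w′ ≺⟨ i ⟩ w″ → ⊥
≺⟨⟩-index-distinct {w′ = w′} d e
  with () ← trans (sym (right-R d)) (trans (at-irrelevant w′ (i<∣w′∣ d) (i<∣w∣ e)) (left-L e))

≺⟨⟩-trans-< : ∀ {w w′ w″ i k} → i < k → w ≺⟨ i ⟩ w′ → w′ ≺⟨ k ⟩ w″ → w ≺⟨ i ⟩ w″
≺⟨⟩-trans-< {w″ = w″} {i} i<k d e = record
  { i<∣w∣   = i<∣w∣ d
  ; i<∣w′∣  = i<∣w″∣
  ; left-L  = left-L d
  ; right-R = R≤lex⇒≡R (subst (_≤lex at w″ i i<∣w″∣) (right-R d)
                              (prefix-≤lex e i<k (i<∣w′∣ d) i<∣w″∣))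
  ; prefix-≤lex = λ j<i p r → let q = <-trans j<i (i<∣w′∣ d) in
      ≤lex-trans (prefix-≤lex d j<i p q) (prefix-≤lex e (<-trans j<i i<k) q r)
  }
  where i<∣w″∣ = <-trans i<k (i<∣w′∣ e)

≺⟨⟩-trans-> : ∀ {w w′ w″ i k} → k < i → w ≺⟨ i ⟩ w′ → w′ ≺⟨ k ⟩ w″ → w ≺⟨ k ⟩ w″
≺⟨⟩-trans-> {w} {k = k} k<i d e = record
  { i<∣w∣   = k<∣w∣
  ; i<∣w′∣  = i<∣w′∣ e
  ; left-L  = ≤lexL⇒≡L (subst (at w k k<∣w∣ ≤lex_) (left-L e)
                              (prefix-≤lex d k<i k<∣w∣ (i<∣w∣ e)))
  ; right-R = right-R e
  ; prefix-≤lex = λ j<k p r → let q = <-trans j<k (i<∣w∣ e) in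
      ≤lex-trans (prefix-≤lex d (<-trans j<k k<i) p q) (prefix-≤lex e j<k q r)
  }
  where k<∣w∣ = <-trans k<i (i<∣w∣ d)

≺-trans : Transitive _≺_
≺-trans {w} {w′} {w″} p q with ≺⇒≺⟨⟩ {w} {w′} p | ≺⇒≺⟨⟩ {w′} {w″} q
... | i , d | k , e with <-cmp i k
... | tri< i<k _ _ = ≺⟨⟩⇒≺ (≺⟨⟩-trans-< i<k d e)
... | tri≈ _ refl _ with () ← ≺⟨⟩-index-distinct d e
... | tri> _ _ k<i = ≺⟨⟩⇒≺ (≺⟨⟩-trans-> k<i d e)

≺-irrefl : Irreflexive _≡_ _≺_
≺-irrefl {w} refl p with () ← ≺⟨⟩-irrefl (proj₂ (≺⇒≺⟨⟩ {w} {w} p))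

≺-asym : Asymmetric _≺_
≺-asym {w} {w′} p q = ≺-irrefl {w} refl (≺-trans {w} {w′} {w} p q)

⪯-trans : Transitive _⪯_
⪯-trans (inj₁ refl) q           = q
⪯-trans (inj₂ p)    (inj₁ refl) = inj₂ p
⪯-trans {w} {w′} {w″} (inj₂ p) (inj₂ q) = inj₂ (≺-trans {w} {w′} {w″} p q)

⪯-antisym : Antisymmetric _≡_ _⪯_
⪯-antisym (inj₁ w≡w′) _           = w≡w′
⪯-antisym (inj₂ _)    (inj₁ w′≡w) = sym w′≡w
⪯-antisym {w} {w′} (inj₂ p) (inj₂ q) with () ← ≺-asym {w} {w′} p q

proposition4p7 : IsPartialOrder {A = Word} _≡_ _⪯_
proposition4p7 = record
  { isPreorder = record
    { isEquivalence = isEquivalence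
    ; reflexive     = inj₁
    ; trans         = ⪯-trans
    }
  ; antisym = ⪯-antisym
  }
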